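{- For every positive integer $r$ there exists a graph $G$ with an edge $e$ such that $\chi_{\rho}(G)-\chi_{\rho}(G-e)\ge r$.
   Context: All graphs are finite and simple. For a graph $G$ with shortest-path distance $d_G$ (distance between vertices in different components is infinite), a $k$-packing coloring is a map $c:V(G)\to\{1,\dots,k\}$ such that whenever $c(u)=c(v)=i$ for distinct $u,v$, we have $d_G(u,v)>i$. The packing chromatic number $\chi_{\rho}(G)$ is the smallest $k$ for which a $k$-packing coloring exists. $G-e$ denotes the graph obtained by deleting the edge $e$. -}

module Defs where

open import Data.Nat using (ℕ; zero; suc; _≤_; _<_)
open import Data.Fin using (Fin; toℕ)
open import Data.Product using (Σ; _×_; _,_; ∃)
open import Data.Empty using (⊥)
open import Relation.Nullary using (¬_)
open import Relation.Binary.PropositionalEquality using (_≡_; _≢_)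

record Graph (n : ℕ) : Set₁ where
  field
    Adj    : Fin n → Fin n → Set
    sym    : ∀ {u v} → Adj u v → Adj v u
    irrefl : ∀ {u} → ¬ Adj u u
open Graph public

data Walk {n : ℕ} (G : Graph n) : Fin n → Fin n → ℕ → Set where
  here : ∀ {u} → Walk G u u zero
  step : ∀ {u w v k} → Adj G u w → Walk G w v k → Walk G u v (suc k)

-- d_G(u,v) ≤ i  (distance infinite between components: no walk at all)
DistLe : ∀ {n} → Graph n → Fin n → Fin n → ℕ → Set
DistLe G u v i = ∃ λ k → k ≤ i × Walk G u v k

-- k-packing coloring: colour j : Fin k stands for the integer toℕ j + 1.
-- Same colour i on distinct u, v forces d_G(u,v) > i.
IsPackingColoring : ∀ {n} (G : Graph n) (k : ℕ) → (Fin n → Fin k) → Set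
IsPackingColoring G k c =
  ∀ u v → u ≢ v → c u ≡ c v → ¬ DistLe G u v (suc (toℕ (c u)))

PackingColorable : ∀ {n} → Graph n → ℕ → Set
PackingColorable {n} G k = Σ (Fin n → Fin k) (IsPackingColoring G k)

PackingChromaticNumber : ∀ {n} → Graph n → ℕ → Set
PackingChromaticNumber G m =
  PackingColorable G m × (∀ k → k < m → ¬ PackingColorable G k)

deleteEdge : ∀ {n} (G : Graph n) (x y : Fin n) → Graph n
deleteEdge G x y = record
  { Adj    = λ u v → Adj G u v × ¬ (u ≡ x × v ≡ y) × ¬ (u ≡ y × v ≡ x)
  ; sym    = λ { (a , p , q) → sym G a , (λ { (e1 , e2) → q (e2 , e1) })
                                       , (λ { (e1 , e2) → p (e2 , e1) }) }
  ; irrefl = λ { (a , _ , _) → irrefl G a }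
  }

-- Take two copies of the clique K_m, m = r + 2, joined by a single edge e.  Without e the
-- graph is two disjoint cliques, so m colors suffice and are needed.  With e the diameter
-- is 3, so every color from 3 on occurs at most once, while the colors 1 and 2 occur at
-- most once per clique: hence χ_ρ(G) ≥ 2m − 2 = m + r.  Choosing both ends of e outside the
-- vertices colored 1 and 2, these colors can be reused across the bridge, so χ_ρ(G) = m + r.
module Submission where

open import Defs hiding (sym)
open import Data.Bool using (Bool; true; false)
open import Data.Bool.Properties using () renaming (_≟_ to _≟ᵇ_)
open import Data.Fin using (Fin; zero; suc; toℕ; _↑ˡ_; _↑ʳ_; splitAt; join)
open import Data.Fin.Properties
  using (_≟_; toℕ-↑ˡ; toℕ<n; toℕ-injective; ↑ˡ-injective; injective⇒≤;
         splitAt-↑ˡ; splitAt-↑ʳ; splitAt-join; join-splitAt)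
open import Data.Nat using (ℕ; suc; _+_; _≤_; _<_; z≤n; s≤s)
open import Data.Nat.Properties
  using (≤-refl; ≤-trans; <⇒≱; +-mono-≤; +-cancelˡ-≤; +-comm; m≤n⇒m≤1+n; module ≤-Reasoning)
open import Data.Product using (Σ; ∃; _×_; _,_)
open import Data.Sum using (_⊎_; inj₁; inj₂; [_,_]′; map₁; reduce)
import Data.Sum as Sum
open import Data.Sum.Properties using ([,]-map)
open import Function using (id; const; _∘_)
open import Relation.Nullary using (¬_; yes; no; contradiction)
open import Relation.Nullary.Decidable using (decidable-stable)
open import Relation.Binary.PropositionalEquality
  using (_≡_; _≢_; refl; sym; trans; cong; subst; module ≡-Reasoning)

isRight : ∀ {A B : Set} → A ⊎ B → Bool
isRight = [ const false , const true ]′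

isRight-reduce-injective : ∀ {A : Set} (s t : A ⊎ A) →
  isRight s ≡ isRight t → reduce s ≡ reduce t → s ≡ t
isRight-reduce-injective (inj₁ _) (inj₁ _) _  refl = refl
isRight-reduce-injective (inj₂ _) (inj₂ _) _  refl = refl
isRight-reduce-injective (inj₁ _) (inj₂ _) () _
isRight-reduce-injective (inj₂ _) (inj₁ _) () _

inj₁≡map₁⇒∃ : ∀ {A B C : Set} {a : A} {f : B → A} (s : B ⊎ C) →
  inj₁ a ≡ map₁ f s → ∃ λ b → a ≡ f b
inj₁≡map₁⇒∃ (inj₁ b) refl = b , refl

splitAt-injective : ∀ m {n} {i j : Fin (m + n)} → splitAt m i ≡ splitAt m j → i ≡ j
splitAt-injective m {n} {i} {j} eq =
  trans (sym (join-splitAt m n i)) (trans (cong (join m n) eq) (join-splitAt m n j))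

join-injective : ∀ m n {s t : Fin m ⊎ Fin n} → join m n s ≡ join m n t → s ≡ t
join-injective m n {s} {t} eq =
  trans (sym (splitAt-join m n s)) (trans (cong (splitAt m) eq) (splitAt-join m n t))

↑ˡ≢↑ʳ : ∀ {m n} {i : Fin m} {j : Fin n} → i ↑ˡ n ≢ m ↑ʳ j
↑ˡ≢↑ʳ {m} {n} {i} {j} eq
  with () ← trans (sym (splitAt-↑ˡ m i n)) (trans (cong (splitAt m) eq) (splitAt-↑ʳ m n j))

mkPackingChromaticNumber : ∀ {n} {G : Graph n} {m} → PackingColorable G m →
  (∀ k → PackingColorable G k → m ≤ k) → PackingChromaticNumber G m
mkPackingChromaticNumber colorable least =
  colorable , λ k k<m colorableₖ → <⇒≱ k<m (least k colorableₖ)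

slot : ∀ {k} → Bool → Fin k → Fin 2 ⊎ Fin k
slot false a                = inj₂ a
slot true  zero             = inj₁ zero
slot true  (suc zero)       = inj₁ (suc zero)
slot true  a@(suc (suc _))  = inj₂ a

toℕ-slot : ∀ {k} s (a : Fin k) → [ toℕ , toℕ ]′ (slot s a) ≡ toℕ a
toℕ-slot false a               = refl
toℕ-slot true  zero            = refl
toℕ-slot true  (suc zero)      = refl
toℕ-slot true  (suc (suc a))   = refl

slot-injective : ∀ {k} s {a b : Fin k} → slot s a ≡ slot s b → a ≡ b
slot-injective s {a} {b} eq = toℕ-injective (begin
  toℕ a                    ≡⟨ sym (toℕ-slot s a) ⟩
  [ toℕ , toℕ ]′ (slot s a) ≡⟨ cong [ toℕ , toℕ ]′ eq ⟩
  [ toℕ , toℕ ]′ (slot s b) ≡⟨ toℕ-slot s b ⟩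
  toℕ b                    ∎)
  where open ≡-Reasoning

slot-collision : ∀ {k} {a b : Fin k} → slot false a ≡ slot true b → a ≡ b × 2 ≤ toℕ a
slot-collision {b = zero}          ()
slot-collision {b = suc zero}      ()
slot-collision {b = suc (suc _)}   refl = refl , s≤s (s≤s z≤n)

module _ {n : ℕ} {G : Graph n} where

  _++ʷ_ : ∀ {u w v i j} → Walk G u w i → Walk G w v j → Walk G u v (i + j)
  here     ++ʷ q = q
  step e p ++ʷ q = step e (p ++ʷ q)

  adjacent⇒distLe1 : ∀ {u v} → Adj G u v → DistLe G u v 1
  adjacent⇒distLe1 e = 1 , ≤-refl , step e here

  distLe-mono : ∀ {u v i j} → i ≤ j → DistLe G u v i → DistLe G u v j
  distLe-mono i≤j (k , k≤i , p) = k , ≤-trans k≤i i≤j , p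

  distLe-trans : ∀ {u w v i j} → DistLe G u w i → DistLe G w v j → DistLe G u v (i + j)
  distLe-trans (k , k≤i , p) (l , l≤j , q) = k + l , +-mono-≤ k≤i l≤j , p ++ʷ q

  sameColor∧close⇒≡ : ∀ {k c d u v} → IsPackingColoring G k c → c u ≡ c v →
    (u ≢ v → DistLe G u v d) → d ≤ suc (toℕ (c u)) → u ≡ v
  sameColor∧close⇒≡ {u = u} {v} valid same close d≤ =
    decidable-stable (u ≟ v) λ u≢v → valid u v u≢v same (distLe-mono d≤ (close u≢v))

  IsClique : ∀ {m} → (Fin m → Fin n) → Set
  IsClique e = ∀ {i j} → i ≢ j → Adj G (e i) (e j)

  clique-injective : ∀ {m} {e : Fin m → Fin n} → IsClique e → ∀ {i j} → e i ≡ e j → i ≡ j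
  clique-injective {e = e} clique {i} {j} eq = decidable-stable (i ≟ j) λ i≢j →
    irrefl G (subst (Adj G (e i)) (sym eq) (clique i≢j))

  clique⇒size≤colors : ∀ {m k} {e : Fin m → Fin n} → IsClique e → PackingColorable G k → m ≤ k
  clique⇒size≤colors {e = e} clique (c , valid) = injective⇒≤ λ same →
    clique-injective clique
      (sameColor∧close⇒≡ valid same (λ ne → adjacent⇒distLe1 (clique (ne ∘ cong e))) (s≤s z≤n))

  twoCliques∧diameter≤3⇒order≤2+colors : ∀ {k} (side : Fin n → Bool) →
    (∀ {u v} → u ≢ v → side u ≡ side v → Adj G u v) →
    (∀ u v → DistLe G u v 3) →
    PackingColorable G k → n ≤ 2 + k
  twoCliques∧diameter≤3⇒order≤2+colors {k} side clique diameter (c , valid) =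
    injective⇒≤ (slots-injective ∘ join-injective 2 k)
    where
    sameSide : ∀ {u v} → side u ≡ side v → c u ≡ c v → u ≡ v
    sameSide s same = sameColor∧close⇒≡ valid same (λ ne → adjacent⇒distLe1 (clique ne s)) (s≤s z≤n)

    largeColor : ∀ {u v} → c u ≡ c v × 2 ≤ toℕ (c u) → u ≡ v
    largeColor {u} {v} (same , large) = sameColor∧close⇒≡ valid same (λ _ → diameter u v) (s≤s large)

    slots-injective : ∀ {u v} → slot (side u) (c u) ≡ slot (side v) (c v) → u ≡ v
    slots-injective {u} {v} eq with side u in su | side v in sv
    ... | false | false = sameSide (trans su (sym sv)) (slot-injective false eq)
    ... | true  | true  = sameSide (trans su (sym sv)) (slot-injective true eq)
    ... | false | true  = largeColor (slot-collision eq)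
    ... | true  | false = sym (largeColor (slot-collision (sym eq)))

-- Two copies of K_m on Fin (m + m), the a-th vertex of the first joined to the b-th of the second.
module BridgedCliques (m : ℕ) (a b : Fin m) where

  side : Fin (m + m) → Bool
  side = isRight ∘ splitAt m

  index : Fin (m + m) → Fin m
  index = reduce ∘ splitAt m

  side-↑ˡ : ∀ i → side (i ↑ˡ m) ≡ false
  side-↑ˡ i = cong isRight (splitAt-↑ˡ m i m)

  side-↑ʳ : ∀ j → side (m ↑ʳ j) ≡ true
  side-↑ʳ j = cong isRight (splitAt-↑ʳ m m j)

  index-↑ˡ : ∀ i → index (i ↑ˡ m) ≡ i
  index-↑ˡ i = cong reduce (splitAt-↑ˡ m i m)

  index-↑ʳ : ∀ j → index (m ↑ʳ j) ≡ j
  index-↑ʳ j = cong reduce (splitAt-↑ʳ m m j)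

  side-index-injective : ∀ {u v} → side u ≡ side v → index u ≡ index v → u ≡ v
  side-index-injective {u} {v} s i =
    splitAt-injective m (isRight-reduce-injective (splitAt m u) (splitAt m v) s i)

  x y : Fin (m + m)
  x = a ↑ˡ m
  y = m ↑ʳ b

  side-x≢side-y : side x ≢ side y
  side-x≢side-y eq with () ← trans (sym (side-↑ˡ a)) (trans eq (side-↑ʳ b))

  Bridge : Fin (m + m) → Fin (m + m) → Set
  Bridge u v = (u ≡ x × v ≡ y) ⊎ (u ≡ y × v ≡ x)

  bridge-sym : ∀ {u v} → Bridge u v → Bridge v u
  bridge-sym (inj₁ (p , q)) = inj₂ (q , p)
  bridge-sym (inj₂ (p , q)) = inj₁ (q , p)

  sameSide⇒¬Bridge : ∀ {u v} → side u ≡ side v → ¬ Bridge u v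
  sameSide⇒¬Bridge s (inj₁ (refl , refl)) = side-x≢side-y s
  sameSide⇒¬Bridge s (inj₂ (refl , refl)) = side-x≢side-y (sym s)

  G : Graph (m + m)
  G = record
    { Adj    = λ u v → u ≢ v × (side u ≡ side v ⊎ Bridge u v)
    ; sym    = λ { (u≢v , link) → u≢v ∘ sym , Sum.map sym bridge-sym link }
    ; irrefl = λ { (u≢u , _) → u≢u refl }
    }

  x~y : Adj G x y
  x~y = side-x≢side-y ∘ cong side , inj₂ (inj₁ (refl , refl))

  y~x : Adj G y x
  y~x = side-x≢side-y ∘ cong side ∘ sym , inj₂ (inj₂ (refl , refl))

  sameSide⇒distLe1 : ∀ {u v} → side u ≡ side v → DistLe G u v 1
  sameSide⇒distLe1 {u} {v} s with u ≟ v
  ... | yes refl = 0 , z≤n , here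
  ... | no u≢v   = adjacent⇒distLe1 (u≢v , inj₁ s)

  viaBridge : ∀ {u v x′ y′} → Adj G x′ y′ → side u ≡ side x′ → side y′ ≡ side v → DistLe G u v 3
  viaBridge e su sv =
    distLe-trans (sameSide⇒distLe1 su) (distLe-trans (adjacent⇒distLe1 e) (sameSide⇒distLe1 sv))

  diameter≤3 : ∀ u v → DistLe G u v 3
  diameter≤3 u v with side u in su | side v in sv
  ... | false | false = distLe-mono (s≤s z≤n) (sameSide⇒distLe1 (trans su (sym sv)))
  ... | true  | true  = distLe-mono (s≤s z≤n) (sameSide⇒distLe1 (trans su (sym sv)))
  ... | false | true  = viaBridge x~y (trans su (sym (side-↑ˡ a))) (trans (side-↑ʳ b) (sym sv))
  ... | true  | false = viaBridge y~x (trans su (sym (side-↑ʳ b))) (trans (side-↑ˡ a) (sym sv))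

  G-order≤2+colors : ∀ {k} → PackingColorable G k → m + m ≤ 2 + k
  G-order≤2+colors = twoCliques∧diameter≤3⇒order≤2+colors side (λ u≢v s → u≢v , inj₁ s) diameter≤3

  Inner : Fin (m + m) → Set
  Inner v = v ≢ x × v ≢ y

  inner-adjacent⇒sameSide : ∀ {u w} → Inner u → Adj G u w → side u ≡ side w
  inner-adjacent⇒sameSide _         (_ , inj₁ s)                = s
  inner-adjacent⇒sameSide (u≢x , _) (_ , inj₂ (inj₁ (u≡x , _))) = contradiction u≡x u≢x
  inner-adjacent⇒sameSide (_ , u≢y) (_ , inj₂ (inj₂ (u≡y , _))) = contradiction u≡y u≢y

  crossingWalk⇒2≤length : ∀ {u v k} → Walk G u v k → side u ≢ side v → Inner v → 2 ≤ k
  crossingWalk⇒2≤length here                                 s≢ _         = contradiction refl s≢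
  crossingWalk⇒2≤length (step (_ , inj₁ s) p)                s≢ v         =
    m≤n⇒m≤1+n (crossingWalk⇒2≤length p (s≢ ∘ trans s) v)
  crossingWalk⇒2≤length (step (_ , inj₂ _) (step _ _))       _  _         = s≤s (s≤s z≤n)
  crossingWalk⇒2≤length (step (_ , inj₂ (inj₁ (_ , refl))) here) _ (_ , v≢y) = contradiction refl v≢y
  crossingWalk⇒2≤length (step (_ , inj₂ (inj₂ (_ , refl))) here) _ (v≢x , _) = contradiction refl v≢x

  crossingWalk⇒3≤length : ∀ {u v k} → Walk G u v k → side u ≢ side v → Inner u → Inner v → 3 ≤ k
  crossingWalk⇒3≤length here       s≢ _ _ = contradiction refl s≢
  crossingWalk⇒3≤length (step e p) s≢ u v =
    s≤s (crossingWalk⇒2≤length p (s≢ ∘ trans (inner-adjacent⇒sameSide u e)) v)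

  inner-crossing-far : ∀ {u v} → Inner u → Inner v → side u ≢ side v → ¬ DistLe G u v 2
  inner-crossing-far u v s≢ (k , k≤2 , p) = <⇒≱ (s≤s k≤2) (crossingWalk⇒3≤length p s≢ u v)

  G′ : Graph (m + m)
  G′ = deleteEdge G x y

  G′-adjacent⇒sameSide : ∀ {u v} → Adj G′ u v → side u ≡ side v
  G′-adjacent⇒sameSide ((_ , inj₁ s) , _)             = s
  G′-adjacent⇒sameSide ((_ , inj₂ (inj₁ xy)) , ¬xy , _) = contradiction xy ¬xy
  G′-adjacent⇒sameSide ((_ , inj₂ (inj₂ yx)) , _ , ¬yx) = contradiction yx ¬yx

  G′-walk⇒sameSide : ∀ {u v k} → Walk G′ u v k → side u ≡ side v
  G′-walk⇒sameSide here       = refl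
  G′-walk⇒sameSide (step e p) = trans (G′-adjacent⇒sameSide e) (G′-walk⇒sameSide p)

  sameSide⇒G′-adjacent : ∀ {u v} → u ≢ v → side u ≡ side v → Adj G′ u v
  sameSide⇒G′-adjacent u≢v s = (u≢v , inj₁ s) , sameSide⇒¬Bridge s ∘ inj₁ , sameSide⇒¬Bridge s ∘ inj₂

  χ-G′ : PackingChromaticNumber G′ m
  χ-G′ = mkPackingChromaticNumber (index , index-valid) λ _ → clique⇒size≤colors firstClique
    where
    index-valid : IsPackingColoring G′ m index
    index-valid u v u≢v same (_ , _ , p) = u≢v (side-index-injective (G′-walk⇒sameSide p) same)

    firstClique : IsClique {G = G′} (_↑ˡ m)
    firstClique {i} {j} i≢j =
      sameSide⇒G′-adjacent (i≢j ∘ ↑ˡ-injective m i j) (trans (side-↑ˡ i) (sym (side-↑ˡ j)))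

-- With m = 2 + r, the first clique is colored by index; the second reuses the colors 1 and 2
-- on its vertices of index 0 and 1 and gets r new colors elsewhere.  The bridge ends must
-- have index ≥ 2, so that the vertices sharing a color are at distance 3.
module BridgedCliquesColoring (r : ℕ) (a b : Fin r) where

  open BridgedCliques (2 + r) (2 ↑ʳ a) (2 ↑ʳ b)

  tag : Bool → Fin (2 + r) → Fin (2 + r) ⊎ Fin r
  tag false i = inj₁ i
  tag true  j = map₁ (_↑ˡ r) (splitAt 2 j)

  untag : Fin (2 + r) ⊎ Fin r → Fin (2 + r)
  untag = [ id , 2 ↑ʳ_ ]′

  untag-tag : ∀ s i → untag (tag s i) ≡ i
  untag-tag false i = refl
  untag-tag true  j = trans ([,]-map (splitAt 2 j)) (join-splitAt 2 r j)

  colorOf : Bool → Fin (2 + r) → Fin (2 + r + r)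
  colorOf s i = join (2 + r) r (tag s i)

  color : Fin (2 + r + (2 + r)) → Fin (2 + r + r)
  color v = colorOf (side v) (index v)

  colorOf-index : ∀ {s t i j} → colorOf s i ≡ colorOf t j → i ≡ j
  colorOf-index {s} {t} {i} {j} eq = begin
    i               ≡⟨ sym (untag-tag s i) ⟩
    untag (tag s i) ≡⟨ cong untag (join-injective (2 + r) r {tag s i} {tag t j} eq) ⟩
    untag (tag t j) ≡⟨ untag-tag t j ⟩
    j               ∎
    where open ≡-Reasoning

  Small : Fin (2 + r) → Set
  Small i = Σ (Fin 2) λ t → i ≡ t ↑ˡ r

  colorOf-crossing : ∀ {s t i} → s ≢ t → colorOf s i ≡ colorOf t i → Small i
  colorOf-crossing {false} {false} s≢t _  = contradiction refl s≢t
  colorOf-crossing {true}  {true}  s≢t _  = contradiction refl s≢t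
  colorOf-crossing {false} {true}  {i} _ eq = inj₁≡map₁⇒∃ (splitAt 2 i) (join-injective (2 + r) r eq)
  colorOf-crossing {true}  {false} {i} _ eq =
    inj₁≡map₁⇒∃ (splitAt 2 i) (sym (join-injective (2 + r) r eq))

  colorOf-small : ∀ s (t : Fin 2) → colorOf s (t ↑ˡ r) ≡ (t ↑ˡ r) ↑ˡ r
  colorOf-small false t = refl
  colorOf-small true  t = cong (join (2 + r) r ∘ map₁ (_↑ˡ r)) (splitAt-↑ˡ 2 t r)

  toℕ-colorOf-small : ∀ s {i} → Small i → toℕ (colorOf s i) < 2
  toℕ-colorOf-small s (t , refl) = begin-strict
    toℕ (colorOf s (t ↑ˡ r)) ≡⟨ cong toℕ (colorOf-small s t) ⟩
    toℕ ((t ↑ˡ r) ↑ˡ r)      ≡⟨ toℕ-↑ˡ (t ↑ˡ r) r ⟩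
    toℕ (t ↑ˡ r)             ≡⟨ toℕ-↑ˡ t r ⟩
    toℕ t                    <⟨ toℕ<n t ⟩
    2                        ∎
    where open ≤-Reasoning

  small⇒inner : ∀ {v} → Small (index v) → Inner v
  small⇒inner (t , small) =
    (λ v≡x → ↑ˡ≢↑ʳ (trans (sym small) (trans (cong index v≡x) (index-↑ˡ (2 ↑ʳ a))))) ,
    (λ v≡y → ↑ˡ≢↑ʳ (trans (sym small) (trans (cong index v≡y) (index-↑ʳ (2 ↑ʳ b)))))

  crossing-far : ∀ {u v} → side u ≢ side v → color u ≡ color v →
    ¬ DistLe G u v (suc (toℕ (color u)))
  crossing-far {u} {v} s≢ same =
    inner-crossing-far (small⇒inner smallᵤ) (small⇒inner (subst Small sameIndex smallᵤ)) s≢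
      ∘ distLe-mono (toℕ-colorOf-small (side u) smallᵤ)
    where
    sameIndex : index u ≡ index v
    sameIndex = colorOf-index {side u} {side v} same

    smallᵤ : Small (index u)
    smallᵤ = colorOf-crossing s≢ (trans same (cong (colorOf (side v)) (sym sameIndex)))

  color-valid : IsPackingColoring G (2 + r + r) color
  color-valid u v u≢v same with side u ≟ᵇ side v
  ... | yes s  = contradiction (side-index-injective s (colorOf-index {side u} {side v} same)) u≢v
  ... | no  s≢ = crossing-far s≢ same

proposition3p1 : (r : ℕ) → 1 ≤ r →
    Σ ℕ λ n → Σ (Graph n) λ G → Σ (Fin n) λ x → Σ (Fin n) λ y → Adj G x y ×
      Σ ℕ λ a → Σ ℕ λ b →
        PackingChromaticNumber G a × PackingChromaticNumber (deleteEdge G x y) b × b + r ≤ a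
proposition3p1 (suc r) _ =
  m + m , G , x , y , x~y , m + suc r , m ,
  mkPackingChromaticNumber (color , color-valid) colors≥ , χ-G′ , ≤-refl
  where
  m : ℕ
  m = 2 + suc r

  open BridgedCliques m (2 ↑ʳ zero) (2 ↑ʳ zero)
  open BridgedCliquesColoring (suc r) zero zero using (color; color-valid)

  colors≥ : ∀ k → PackingColorable G k → m + suc r ≤ k
  colors≥ k colorable =
    subst (_≤ k) (+-comm (suc r) m) (+-cancelˡ-≤ 2 (suc r + m) k (G-order≤2+colors colorable))
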